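{- Let $m_1\geq\dots\geq m_t$ be positive integers and let $M_{m_1}^k,\dots,M_{m_t}^k$ be $k$-uniform matchings of sizes $m_1,\dots,m_t$. Then \[ \log_2\left(km_1+\sum_{i=2}^t(m_i-1)\right)\leq\operatorname{BR}^k(M_{m_1}^k,\dots,M_{m_t}^k)\leq\left\lceil\log_2\left(1+\sum_{i=1}^t(m_i-1)\right)\right\rceil+k-1. \]
   Context: A $k$-chain in a poset is a set of $k$ distinct pairwise comparable elements. A $k$-uniform pograph $H$ is a poset $(V(H),\le)$ with a set $E(H)$ of edges, each a $k$-chain. The $k$-uniform matching $M_m^k$ of size $m$ is the pograph whose poset is the disjoint union of $m$ chains of $k$ elements each (elements in different chains incomparable), with these $m$ chains as its edges. Given a coloring of the $k$-chains of a poset $Q$, a copy of $H$ in color $i$ is an injection $f:V(H)\to Q$ with $f(x)\le f(y)$ whenever $x\le y$, such that $f(e)$ has color $i$ for all $e\in E(H)$. $\operatorname{BR}^k(G_1,\dots,G_t)$ is the least $N$ such that every coloring of the $k$-chains of the Boolean lattice $B_N$ (subsets of $[N]$ under inclusion) with colors $\{1,\dots,t\}$ contains, for some $i$, a copy of $G_i$ in color $i$. -}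

module Defs where

open import Data.Nat using (ℕ; zero; suc; _+_; _*_; _∸_; _^_; _≤_)
open import Data.Fin using (Fin) renaming (_<_ to _<ᶠ_; _≤_ to _≤ᶠ_)
open import Data.Fin.Subset using (Subset; _⊆_; _⊂_)
open import Data.List using (tabulate)
open import Data.Nat.ListAction using (sum)
open import Data.Product using (Σ; _×_; _,_)
open import Relation.Binary.PropositionalEquality using (_≡_)

-- A k-chain in B_N, listed in increasing order: k distinct pairwise comparable
-- subsets correspond exactly to sequences C : Fin k → Subset N with
-- C i ⊂ C j whenever i < j.
IsChain : ∀ {N} (k : ℕ) → (Fin k → Subset N) → Set
IsChain k C = ∀ (i j : Fin k) → i <ᶠ j → C i ⊂ C j

-- A t-colouring of the k-chains of B_N: a colour is assigned to every
-- increasingly listed k-chain (values on non-chains are irrelevant).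
Colouring : (N k t : ℕ) → Set
Colouring N k t = (Fin k → Subset N) → Fin t

-- The k-uniform matching M_m^k: vertex set Fin m × Fin k, with (a , j) ≤ (a' , j')
-- iff a ≡ a' and j ≤ j'; the edges are the m chains {(a , j) | j : Fin k}.
-- A copy of M_m^k in colour i: an injective order-preserving map
-- f : V(M_m^k) → B_N such that every edge is mapped to a k-chain of colour i.
-- (Since f is injective and monotone, the image of edge a listed in order is
-- λ j → f (a , j).)
CopyOfMatching : ∀ {N k t} → Colouring N k t → (m : ℕ) → Fin t → Set
CopyOfMatching {N} {k} col m i =
  Σ (Fin m × Fin k → Subset N) λ f →
    (∀ x y → f x ≡ f y → x ≡ y)
    × (∀ (a : Fin m) (j j' : Fin k) → j ≤ᶠ j' → f (a , j) ⊆ f (a , j'))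
    × (∀ (a : Fin m) → col (λ j → f (a , j)) ≡ i)

Arrows : (N k t : ℕ) → (Fin t → ℕ) → Set
Arrows N k t m = ∀ (col : Colouring N k t) → Σ (Fin t) λ i → CopyOfMatching col (m i) i

IsBR : (k t : ℕ) → (Fin t → ℕ) → ℕ → Set
IsBR k t m n = Arrows n k t m × (∀ N → Arrows N k t m → n ≤ N)

ΣFin : (s : ℕ) → (Fin s → ℕ) → ℕ
ΣFin s f = sum (tabulate f)

-- Lower bound: colour a k-chain of B_N by the rank of its bottom element, i.e. the
-- binary number read off its characteristic vector, which is monotone under ⊆.
-- Ranks in [S, 2^N), S = Σ_{i≥2} (m_i − 1), get colour 1; the ranks below S are cut
-- into consecutive blocks of lengths m_i − 1, one for each colour i ≥ 2.  A copy of
-- M_{m_i} in colour i ≥ 2 would need m_i distinct bottoms in a block of m_i − 1 ranks,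
-- and a copy of M_{m_1} in colour 1 has k m_1 distinct elements, all of rank in [S, 2^N).
--
-- Upper bound: with 2^n ≥ 1 + Σ_i (m_i − 1), every X ⊆ [n] spans the k-chain
-- X, X ∪ {n+1}, …, X ∪ {n+1, …, n+k−1} in B_{n+k−1}.  By the weighted pigeonhole
-- principle some colour i receives at least m_i of these 2^n chains, and chains with
-- different X are disjoint, so they form a copy of M_{m_i}.
--
-- The least such N exists because Arrows N is decidable by exhaustive search.

module Submission where

open import Defs
open import Data.Bool using (Bool)
open import Data.Bool.Properties using () renaming (_≟_ to _≟ᵇ_)
open import Data.Fin
  using (Fin; toℕ; fromℕ<; lift; inject≤)
  renaming (zero to fzero; suc to fsuc; _≤_ to _≤ᶠ_)
open import Data.Fin.Properties
  using (any?; all?; *↔×; 2↔Bool; lift-injective; suc-injective; inject≤-injective; toℕ-combine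
        ; toℕ<n; toℕ-injective; toℕ-fromℕ<; injective⇒≤)
  renaming (_≟_ to _≟ᶠ_; _≤?_ to _≤ᶠ?_)
open import Data.Fin.Subset using (Subset; _⊆_; ⊥; inside; outside)
open import Data.Fin.Subset.Properties using (_⊆?_; ⊆-refl; ⊥⊆; s⊆s; drop-∷-⊆)
open import Data.Maybe using (Maybe; just; nothing; maybe)
import Data.Maybe as Maybe
open import Data.Nat
  using (ℕ; zero; suc; pred; _+_; _*_; _∸_; _^_; _≤_; _≥_; _<_; _<?_; z≤n; s≤s; ⌊_/2⌋; ⌈_/2⌉
        ; ≢-nonZero)
  renaming (_≟_ to _≟ℕ_)
open import Data.Nat.Induction using (<-rec)
open import Data.Nat.Logarithm using (⌈log₂_⌉; ⌈log₂⌈n/2⌉⌉≡⌈log₂n⌉∸1; ⌈log₂⌉-mono-≤)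
open import Data.Nat.Properties
  using (module ≤-Reasoning; ⌊n/2⌋+⌈n/2⌉≡n; ⌊n/2⌋≤⌈n/2⌉; ⌈n/2⌉<n; +-monoˡ-≤; +-monoʳ-≤; +-mono-≤
        ; *-monoʳ-≤; *-mono-≤; +-identityʳ; +-suc; *-comm; ≤-refl; ≤-trans; ≤-pred; <⇒≤; 1+n≰n; ≮⇒≥
        ; m<1+n⇒m<n∨m≡n; suc-pred; ∸-monoˡ-<; ∸-cancelʳ-≡; m+[n∸m]≡n; m≤o∸n⇒m+n≤o; m∸n≢0⇒n<m)
open import Data.Product using (Σ; ∃; _×_; _,_; proj₁; proj₂; uncurry; map₁)
open import Data.Product.Properties using () renaming (≡-dec to ≡-dec×)
open import Data.Product.Function.NonDependent.Propositional using (_×-↔_)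
open import Data.Sum using (_⊎_; inj₁; inj₂; [_,_]′)
open import Data.Vec using (Vec; []; _∷_; _++_; lookup; tabulate)
open import Data.Vec.Base using (here; there)
open import Data.Vec.Functional using (updateAt)
open import Data.Vec.Functional.Properties using (updateAt-updates; updateAt-minimal)
open import Data.Vec.Properties
  using (lookup∘tabulate; tabulate-cong; ∷-injectiveʳ; ++-injectiveˡ; ++-injectiveʳ)
  renaming (≡-dec to ≡-decVec)
open import Function using (_∘_; _↔_; Inverse; mk↔ₛ′)
open import Function.Bundles using (Injection)
open import Function.Definitions using (Injective)
open import Function.Properties.Inverse using (↔-refl; ↔-sym; ↔-trans; ↔⇒↣)
open import Relation.Binary.PropositionalEquality
  using (_≡_; _≢_; _≗_; refl; sym; trans; cong; cong₂; subst; subst₂)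
open import Relation.Nullary using (Dec; yes; no; ¬_; contradiction)
open import Relation.Nullary.Decidable using (map′; _×-dec_; _→-dec_)
open import Relation.Unary using (Decidable)

private variable
  A B : Set
  a b : ℕ

Vec↔Fin : A ↔ Fin a → ∀ n → Vec A n ↔ Fin (a ^ n)
Vec↔Fin _ zero = mk↔ₛ′ (λ _ → fzero) (λ _ → []) (λ { fzero → refl ; (fsuc ()) }) (λ { [] → refl })
Vec↔Fin A↔Fin (suc n) = ↔-trans ∷↔× (↔-trans (A↔Fin ×-↔ Vec↔Fin A↔Fin n) (↔-sym *↔×))
  where
  ∷↔× : Vec A (suc n) ↔ (A × Vec A n)
  ∷↔× = mk↔ₛ′ (λ { (x ∷ xs) → x , xs }) (uncurry _∷_) (λ _ → refl) (λ { (x ∷ xs) → refl })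

Subset↔Fin : ∀ n → Subset n ↔ Fin (2 ^ n)
Subset↔Fin = Vec↔Fin (↔-sym 2↔Bool)

module _ (A↔Fin : A ↔ Fin a) where
  open Inverse A↔Fin

  any↔? : {P : A → Set} → Decidable P → Dec (∃ P)
  any↔? {P} P? = map′ (λ (i , p) → from i , p)
    (λ (x , p) → to x , subst P (sym (strictlyInverseʳ x)) p) (any? (P? ∘ from))

  all↔? : {P : A → Set} → Decidable P → Dec (∀ x → P x)
  all↔? {P} P? = map′ (λ h x → subst P (strictlyInverseʳ x) (h (to x))) (λ h i → h (from i))
    (all? (P? ∘ from))

module _ (A↔Fin : A ↔ Fin a) (B↔Fin : B ↔ Fin b) {P : (A → B) → Set}
         (P-resp : ∀ {f g} → f ≗ g → P f → P g) (P? : Decidable P) where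
  open Inverse A↔Fin

  private
    fromTable : Vec B a → A → B
    fromTable T = lookup T ∘ to

    fromTable-tabulate : ∀ f → fromTable (tabulate (f ∘ from)) ≗ f
    fromTable-tabulate f x = trans (lookup∘tabulate (f ∘ from) (to x)) (cong f (strictlyInverseʳ x))

  anyFunction? : Dec (∃ P)
  anyFunction? = map′ (λ (T , p) → fromTable T , p)
    (λ (f , p) → tabulate (f ∘ from) , P-resp (sym ∘ fromTable-tabulate f) p)
    (any↔? (Vec↔Fin B↔Fin a) (P? ∘ fromTable))

  allFunctions? : Dec (∀ f → P f)
  allFunctions? = map′ (λ h f → P-resp (fromTable-tabulate f) (h (tabulate (f ∘ from))))
    (λ h T → h (fromTable T))
    (all↔? (Vec↔Fin B↔Fin a) (P? ∘ fromTable))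

private variable
  N k t m : ℕ

IsCopy : Colouring N k t → (m : ℕ) → Fin t → (Fin m × Fin k → Subset N) → Set
IsCopy {k = k} col m i f =
  (∀ x y → f x ≡ f y → x ≡ y)
  × (∀ (a : Fin m) (j j′ : Fin k) → j ≤ᶠ j′ → f (a , j) ⊆ f (a , j′))
  × (∀ (a : Fin m) → col (λ j → f (a , j)) ≡ i)

IsCopy-resp : ∀ (col col′ : Colouring N k t) {i} {f g : Fin m × Fin k → Subset N} → f ≗ g
  → (∀ a → col (λ j → f (a , j)) ≡ col′ (λ j → g (a , j)))
  → IsCopy col m i f → IsCopy col′ m i g
IsCopy-resp _ _ f≗g col≡col′ (inj , mono , colour) =
  (λ x y gx≡gy → inj x y (trans (f≗g x) (trans gx≡gy (sym (f≗g y)))))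
  , (λ a j j′ j≤j′ → subst₂ _⊆_ (f≗g (a , j)) (f≗g (a , j′)) (mono a j j′ j≤j′))
  , λ a → trans (sym (col≡col′ a)) (colour a)

isCopy? : ∀ (col : Colouring N k t) m i → Decidable (IsCopy col m i)
isCopy? col m i f =
  all↔? cells↔ (λ x → all↔? cells↔ λ y → (≡-decVec _≟ᵇ_ (f x) (f y)) →-dec (≡-dec× _≟ᶠ_ _≟ᶠ_ x y))
  ×-dec all? (λ a → all? λ j → all? λ j′ → (j ≤ᶠ? j′) →-dec (f (a , j) ⊆? f (a , j′)))
  ×-dec all? (λ a → col (λ j → f (a , j)) ≟ᶠ i)
  where cells↔ = ↔-sym *↔×

copyOfMatching? : ∀ (col : Colouring N k t) → (∀ {C C′} → C ≗ C′ → col C ≡ col C′)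
  → ∀ m i → Dec (CopyOfMatching col m i)
copyOfMatching? {N} col col-resp m i = anyFunction? (↔-sym *↔×) (Subset↔Fin N)
  (λ f≗g → IsCopy-resp col col f≗g (λ a → col-resp (λ j → f≗g (a , j)))) (isCopy? col m i)

HasCopy : Colouring N k t → (Fin t → ℕ) → Set
HasCopy {t = t} col ms = Σ (Fin t) λ i → CopyOfMatching col (ms i) i

-- Colourings act on functions, which cannot be enumerated.  Those factoring through
-- tabulate suffice: re-tabulating the rows of a copy changes them only pointwise.
arrows-via-tabulate : ∀ {ms : Fin t → ℕ}
  → (∀ (c : Vec (Subset N) k → Fin t) → HasCopy (c ∘ tabulate) ms) → Arrows N k t ms
arrows-via-tabulate has col with has (col ∘ lookup)
... | i , f , copy = i , f′ , IsCopy-resp (col ∘ lookup ∘ tabulate) col f≗f′ (λ _ → refl) copy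
  where
  f′ : _ → _
  f′ (a , j) = lookup (tabulate (λ j → f (a , j))) j
  f≗f′ : f ≗ f′
  f≗f′ (a , j) = sym (lookup∘tabulate _ j)

arrows? : ∀ N k t (ms : Fin t → ℕ) → Dec (Arrows N k t ms)
arrows? N k t ms = map′ arrows-via-tabulate (λ arrows c → arrows (c ∘ tabulate))
  (allFunctions? (Vec↔Fin (Subset↔Fin N) k) ↔-refl
    (λ {c} {c′} c≗c′ (i , f , copy) →
      i , f , IsCopy-resp (c ∘ tabulate) (c′ ∘ tabulate) (λ _ → refl) (λ a → c≗c′ _) copy)
    (λ c → any? λ i → copyOfMatching? (c ∘ tabulate) (cong c ∘ tabulate-cong) (ms i) i))

module _ {P : ℕ → Set} (P? : Decidable P) where
  private
    search : ∀ U → (Σ ℕ λ n → P n × (∀ N → P N → n ≤ N)) ⊎ (∀ N → N < U → ¬ P N)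
    search zero = inj₂ λ _ ()
    search (suc U) with search U | P? U
    ... | inj₁ least | _       = inj₁ least
    ... | inj₂ none  | yes pU = inj₁ (U , pU , λ N pN → ≮⇒≥ λ N<U → none N N<U pN)
    ... | inj₂ none  | no ¬pU = inj₂ λ N N<1+U →
      [ none N , (λ { refl → ¬pU }) ]′ (m<1+n⇒m<n∨m≡n N<1+U)

  least-witness : ∀ U → P U → Σ ℕ λ n → P n × (∀ N → P N → n ≤ N)
  least-witness U pU with search (suc U)
  ... | inj₁ least = least
  ... | inj₂ none  = contradiction pU (none U ≤-refl)

ΣFin-updateAt-pred : (b : Fin t → ℕ) (i : Fin t) → b i ≢ 0
  → ΣFin t b ≡ suc (ΣFin t (updateAt b i pred))
ΣFin-updateAt-pred {suc t} b fzero b₀≢0 =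
  cong (_+ ΣFin t (b ∘ fsuc)) (sym (suc-pred (b fzero) {{≢-nonZero b₀≢0}}))
ΣFin-updateAt-pred {suc t} b (fsuc i) bᵢ≢0 =
  trans (cong (b fzero +_) (ΣFin-updateAt-pred (b ∘ fsuc) i bᵢ≢0)) (+-suc (b fzero) _)

MonochromaticInjection : ∀ {M} → (Fin M → Fin t) → Fin t → ℕ → Set
MonochromaticInjection {M = M} c i n =
  Σ (Fin n → Fin M) λ g → Injective _≡_ _≡_ g × (∀ x → c (g x) ≡ i)

LargeColourClass : ∀ {M} → (Fin M → Fin t) → (Fin t → ℕ) → Set
LargeColourClass {t = t} c b = Σ (Fin t) λ i → Σ ℕ λ n → b i < n × MonochromaticInjection c i n

pigeonhole-weighted : ∀ {M} (c : Fin M → Fin t) (b : Fin t → ℕ) → ΣFin t b < M → LargeColourClass c b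
pigeonhole-weighted {M = suc M} c b ΣFin<M with b (c fzero) ≟ℕ 0
... | yes b≡0 = c fzero , 1 , subst (_< 1) (sym b≡0) ≤-refl
                , (λ _ → fzero) , (λ { {fzero} {fzero} _ → refl }) , λ { fzero → refl }
... | no b≢0 = extend (pigeonhole-weighted (c ∘ fsuc) b′ Σb′<M)
  where
  c₀ = c fzero
  b′ = updateAt b c₀ pred
  Σb′<M : ΣFin _ b′ < M
  Σb′<M = ≤-pred (subst (_< suc M) (ΣFin-updateAt-pred b c₀ b≢0) ΣFin<M)
  extend : LargeColourClass (c ∘ fsuc) b′ → LargeColourClass c b
  extend (i , n , b′ᵢ<n , g , g-inj , g-col) with i ≟ᶠ c₀
  ... | yes refl = i , suc n
    , subst (_< suc n) (suc-pred (b i) {{≢-nonZero b≢0}})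
        (s≤s (subst (_< n) (updateAt-updates i b) b′ᵢ<n))
    , lift 1 g , lift-injective g g-inj 1 , λ { fzero → refl ; (fsuc x) → g-col x }
  ... | no i≢c₀ = i , n , subst (_< n) (updateAt-minimal i c₀ b i≢c₀) b′ᵢ<n
    , fsuc ∘ g , g-inj ∘ suc-injective , g-col

n≤2^⌈log₂n⌉ : ∀ n → n ≤ 2 ^ ⌈log₂ n ⌉
n≤2^⌈log₂n⌉ = <-rec _ go
  where
  go : ∀ n → (∀ {m} → m < n → m ≤ 2 ^ ⌈log₂ m ⌉) → n ≤ 2 ^ ⌈log₂ n ⌉
  go zero _ = z≤n
  go (suc zero) _ = s≤s z≤n
  go n@(suc (suc n-2)) rec = begin
      n                            ≡⟨ ⌊n/2⌋+⌈n/2⌉≡n n ⟨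
      ⌊ n /2⌋ + ⌈ n /2⌉            ≤⟨ +-monoˡ-≤ ⌈ n /2⌉ (⌊n/2⌋≤⌈n/2⌉ n) ⟩
      ⌈ n /2⌉ + ⌈ n /2⌉            ≤⟨ +-mono-≤ half≤ half≤ ⟩
      2 ^ (L ∸ 1) + 2 ^ (L ∸ 1)    ≡⟨ cong (2 ^ (L ∸ 1) +_) (+-identityʳ _) ⟨
      2 ^ suc (L ∸ 1)              ≡⟨ cong (2 ^_) (suc-pred L {{≢-nonZero L≢0}}) ⟩
      2 ^ L                        ∎
    where
    open ≤-Reasoning
    L = ⌈log₂ n ⌉
    half≤ : ⌈ n /2⌉ ≤ 2 ^ (L ∸ 1)
    half≤ = subst (λ e → ⌈ n /2⌉ ≤ 2 ^ e) (⌈log₂⌈n/2⌉⌉≡⌈log₂n⌉∸1 n) (rec (⌈n/2⌉<n n-2))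
    L≢0 : L ≢ 0
    L≢0 L≡0 with subst (1 ≤_) L≡0 (⌈log₂⌉-mono-≤ {2} {n} (s≤s (s≤s z≤n)))
    ... | ()

initialSegment : ∀ {n} → Fin (suc n) → Subset n
initialSegment fzero = ⊥
initialSegment {suc n} (fsuc j) = inside ∷ initialSegment j

initialSegment-injective : ∀ {n} → Injective _≡_ _≡_ (initialSegment {n})
initialSegment-injective {x = fzero} {fzero} _ = refl
initialSegment-injective {suc n} {fzero} {fsuc _} ()
initialSegment-injective {suc n} {fsuc _} {fzero} ()
initialSegment-injective {suc n} {fsuc j} {fsuc j′} eq =
  cong fsuc (initialSegment-injective (∷-injectiveʳ eq))

initialSegment-mono : ∀ {n} {j j′ : Fin (suc n)} → j ≤ᶠ j′ → initialSegment j ⊆ initialSegment j′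
initialSegment-mono {j = fzero} _ = ⊥⊆
initialSegment-mono {suc n} {fsuc j} {fsuc j′} (s≤s j≤j′) = s⊆s (initialSegment-mono j≤j′)

++-mono-⊆ : ∀ {n n′} {p p′ : Subset n} {q q′ : Subset n′} → p ⊆ p′ → q ⊆ q′ → p ++ q ⊆ p′ ++ q′
++-mono-⊆ {p = []} {[]} _ q⊆q′ = q⊆q′
++-mono-⊆ {p = _ ∷ _} {_ ∷ _} p⊆p′ q⊆q′ here with p⊆p′ here
... | here = here
++-mono-⊆ {p = _ ∷ _} {_ ∷ _} p⊆p′ q⊆q′ (there x∈) = there (++-mono-⊆ (drop-∷-⊆ p⊆p′) q⊆q′ x∈)

upper-bound : ∀ n k′ (ms : Fin t → ℕ) → (∀ i → ms i ≥ 1)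
  → ΣFin t (λ i → ms i ∸ 1) < 2 ^ n → Arrows (n + k′) (suc k′) t ms
upper-bound n k′ ms ms≥1 Σ<2^n col
  with pigeonhole-weighted (λ x → col (λ j → decode x ++ initialSegment j)) (λ i → ms i ∸ 1) Σ<2^n
  where decode = Inverse.from (Subset↔Fin n)
... | i , n′ , msᵢ∸1<n′ , g , g-inj , g-col = i , f , f-inj , f-mono , g-col ∘ ι
  where
  m∸1<n⇒m≤n : ∀ {m} → m ≥ 1 → m ∸ 1 < n′ → m ≤ n′
  m∸1<n⇒m≤n (s≤s _) lt = lt
  ι : Fin (ms i) → Fin n′
  ι a = inject≤ a (m∸1<n⇒m≤n (ms≥1 i) msᵢ∸1<n′)
  X : Fin (ms i) → Subset n
  X = Inverse.from (Subset↔Fin n) ∘ g ∘ ι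
  X-injective : Injective _≡_ _≡_ X
  X-injective = inject≤-injective _ _ _ _ ∘ g-inj ∘ Injection.injective (↔⇒↣ (↔-sym (Subset↔Fin n)))
  f : Fin (ms i) × Fin (suc k′) → Subset (n + k′)
  f (a , j) = X a ++ initialSegment j
  f-inj : ∀ x y → f x ≡ f y → x ≡ y
  f-inj (a , j) (a′ , j′) eq =
    cong₂ _,_ (X-injective (++-injectiveˡ _ _ eq)) (initialSegment-injective (++-injectiveʳ _ _ eq))
  f-mono : ∀ a (j j′ : Fin (suc k′)) → j ≤ᶠ j′ → f (a , j) ⊆ f (a , j′)
  f-mono a j j′ j≤j′ = ++-mono-⊆ ⊆-refl (initialSegment-mono j≤j′)

-- The characteristic vector of p read as a binary number, most significant bit first.
rank : ∀ {N} → Subset N → ℕ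
rank {N} p = toℕ (Inverse.to (Subset↔Fin N) p)

rank-< : ∀ {N} (p : Subset N) → rank p < 2 ^ N
rank-< p = toℕ<n _

rank-injective : ∀ {N} → Injective _≡_ _≡_ (rank {N})
rank-injective {N} = Injection.injective (↔⇒↣ (Subset↔Fin N)) ∘ toℕ-injective

private
  bit : Bool → ℕ
  bit outside = 0
  bit inside = 1

  rank-∷ : ∀ {N} x (p : Subset N) → rank (x ∷ p) ≡ 2 ^ N * bit x + rank p
  rank-∷ {N} outside p = toℕ-combine {2} fzero (Inverse.to (Subset↔Fin N) p)
  rank-∷ {N} inside p = toℕ-combine {2} (fsuc fzero) (Inverse.to (Subset↔Fin N) p)

  bit-mono : ∀ {N} {x y} {p q : Subset N} → x ∷ p ⊆ y ∷ q → bit x ≤ bit y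
  bit-mono {x = outside} _ = z≤n
  bit-mono {x = inside} {inside} _ = ≤-refl
  bit-mono {x = inside} {outside} x∷p⊆y∷q with x∷p⊆y∷q here
  ... | ()

rank-mono : ∀ {N} {p q : Subset N} → p ⊆ q → rank p ≤ rank q
rank-mono {p = []} {[]} _ = ≤-refl
rank-mono {suc N} {x ∷ p} {y ∷ q} x∷p⊆y∷q = begin
  rank (x ∷ p)              ≡⟨ rank-∷ x p ⟩
  2 ^ N * bit x + rank p    ≤⟨ +-mono-≤ (*-monoʳ-≤ (2 ^ N) (bit-mono x∷p⊆y∷q))
                                        (rank-mono (drop-∷-⊆ x∷p⊆y∷q)) ⟩
  2 ^ N * bit y + rank q    ≡⟨ rank-∷ y q ⟨
  rank (y ∷ q)              ∎
  where open ≤-Reasoning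

-- block b v = just (i , o) when v is at offset o in the i-th of the consecutive
-- intervals of lengths b 0, b 1, …, and nothing when v ≥ ΣFin s b.
block : ∀ {s} → (Fin s → ℕ) → ℕ → Maybe (Fin s × ℕ)
block {zero} b v = nothing
block {suc s} b v with v <? b fzero
... | yes _ = just (fzero , v)
... | no _ = Maybe.map (map₁ fsuc) (block (b ∘ fsuc) (v ∸ b fzero))

block-nothing : ∀ {s} (b : Fin s → ℕ) v → block b v ≡ nothing → ΣFin s b ≤ v
block-nothing {zero} b v _ = z≤n
block-nothing {suc s} b v eq with v <? b fzero
... | no v≮b₀ with block (b ∘ fsuc) (v ∸ b fzero) in eq′
...   | nothing = subst (ΣFin (suc s) b ≤_) (m+[n∸m]≡n (≮⇒≥ v≮b₀))
                    (+-monoʳ-≤ (b fzero) (block-nothing (b ∘ fsuc) (v ∸ b fzero) eq′))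

block-just-< : ∀ {s} (b : Fin s → ℕ) v {i o} → block b v ≡ just (i , o) → o < b i
block-just-< {suc s} b v eq with v <? b fzero
block-just-< {suc s} b v refl | yes v<b₀ = v<b₀
... | no _ with block (b ∘ fsuc) (v ∸ b fzero) in eq′
block-just-< {suc s} b v refl | no _ | just _ = block-just-< (b ∘ fsuc) (v ∸ b fzero) eq′

block-injective : ∀ {s} (b : Fin s → ℕ) v w {x} → block b v ≡ just x → block b w ≡ just x → v ≡ w
block-injective {suc s} b v w eqv eqw with v <? b fzero | w <? b fzero
block-injective b v w refl refl | yes _ | yes _ = refl
block-injective b v w eqv eqw | yes _ | no _ with block (b ∘ fsuc) (w ∸ b fzero)
block-injective b v w refl () | yes _ | no _ | just _
block-injective b v w eqv eqw | no _ | yes _ with block (b ∘ fsuc) (v ∸ b fzero)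
block-injective b v w () refl | no _ | yes _ | just _
block-injective b v w eqv eqw | no v≮b₀ | no w≮b₀
  with block (b ∘ fsuc) (v ∸ b fzero) in eqv′ | block (b ∘ fsuc) (w ∸ b fzero) in eqw′
block-injective b v w refl refl | no v≮b₀ | no w≮b₀ | just _ | just _ =
  ∸-cancelʳ-≡ (≮⇒≥ v≮b₀) (≮⇒≥ w≮b₀)
    (block-injective (b ∘ fsuc) (v ∸ b fzero) (w ∸ b fzero) eqv′ eqw′)

blockColour : ∀ {s} → (Fin s → ℕ) → ℕ → Fin (suc s)
blockColour b v = maybe (fsuc ∘ proj₁) fzero (block b v)

blockColour-zero : ∀ {s} (b : Fin s → ℕ) v → blockColour b v ≡ fzero → block b v ≡ nothing
blockColour-zero b v eq with block b v
... | nothing = refl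

blockColour-suc : ∀ {s} (b : Fin s → ℕ) v {i} → blockColour b v ≡ fsuc i → ∃ λ o → block b v ≡ just (i , o)
blockColour-suc b v eq with block b v
blockColour-suc b v refl | just (_ , o) = o , refl

injective-into-interval⇒≤ : ∀ {n lo hi} (g : Fin n → ℕ) → Injective _≡_ _≡_ g
  → (∀ x → lo ≤ g x) → (∀ x → g x < hi) → n ≤ hi ∸ lo
injective-into-interval⇒≤ {lo = lo} g g-inj lo≤g g<hi = injective⇒≤ {f = shifted} λ {x} {y} eq →
  g-inj (∸-cancelʳ-≡ (lo≤g x) (lo≤g y) (trans (sym (toℕ-fromℕ< _)) (trans (cong toℕ eq) (toℕ-fromℕ< _))))
  where
  shifted = λ x → fromℕ< (∸-monoˡ-< (g<hi x) (lo≤g x))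

rankColouring : ∀ {N k s} → (Fin s → ℕ) → Colouring N (suc k) (suc s)
rankColouring b C = blockColour b (rank (C fzero))

small-colour-class : ∀ {N k s m} (b : Fin s → ℕ) i
  → CopyOfMatching (rankColouring {N} {k} b) m (fsuc i) → m ≤ b i
small-colour-class b i (f , f-inj , _ , f-col) =
  injective-into-interval⇒≤ offset offset-injective (λ _ → z≤n)
    (λ a → block-just-< b _ (proj₂ (located a)))
  where
  located = λ a → blockColour-suc b _ (f-col a)
  offset = λ a → proj₁ (located a)
  offset-injective : Injective _≡_ _≡_ offset
  offset-injective {a} {a′} eq = cong proj₁ (f-inj (a , fzero) (a′ , fzero) (rank-injective
    (block-injective b _ _ (proj₂ (located a))
      (subst (λ o → _ ≡ just (i , o)) (sym eq) (proj₂ (located a′))))))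

large-colour-class : ∀ {N k s m} (b : Fin s → ℕ)
  → CopyOfMatching (rankColouring {N} {k} b) m fzero → m * suc k ≤ 2 ^ N ∸ ΣFin s b
large-colour-class {m = m} b (f , f-inj , f-mono , f-col) =
  injective-into-interval⇒≤ (rank ∘ f ∘ cell)
    (Injection.injective (↔⇒↣ *↔×) ∘ f-inj _ _ ∘ rank-injective) (ΣFin≤rank ∘ cell) (rank-< ∘ f ∘ cell)
  where
  cell = Inverse.to (*↔× {m})
  ΣFin≤rank : ∀ x → ΣFin _ b ≤ rank (f x)
  ΣFin≤rank (a , j) =
    ≤-trans (block-nothing b _ (blockColour-zero b _ (f-col a))) (rank-mono (f-mono a fzero j z≤n))

lower-bound : ∀ N k′ s (ms : Fin (suc s) → ℕ) → (∀ i → ms i ≥ 1) → Arrows N (suc k′) (suc s) ms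
  → suc k′ * ms fzero + ΣFin s (λ i → ms (fsuc i) ∸ 1) ≤ 2 ^ N
lower-bound N k′ s ms ms≥1 arrows with arrows (rankColouring (λ i → ms (fsuc i) ∸ 1))
... | fsuc i , copy = contradiction (small-colour-class _ i copy) (m≰m∸1 (ms≥1 (fsuc i)))
  where
  m≰m∸1 : ∀ {m} → m ≥ 1 → ¬ m ≤ m ∸ 1
  m≰m∸1 (s≤s _) = 1+n≰n
... | fzero , copy =
  subst (λ x → x + S ≤ 2 ^ N) (*-comm (ms fzero) (suc k′)) (m≤o∸n⇒m+n≤o _ (<⇒≤ S<2^N) cells≤)
  where
  S = ΣFin s (λ i → ms (fsuc i) ∸ 1)
  cells≤ : ms fzero * suc k′ ≤ 2 ^ N ∸ S
  cells≤ = large-colour-class _ copy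
  S<2^N : S < 2 ^ N
  S<2^N = m∸n≢0⇒n<m λ eq →
    contradiction (subst (1 ≤_) eq (≤-trans (*-mono-≤ (ms≥1 fzero) (s≤s z≤n)) cells≤)) λ ()

theorem3p3 : (k s : ℕ) → k ≥ 1 → (m : Fin (suc s) → ℕ)
    → (∀ i → m i ≥ 1)
    → (∀ i j → i ≤ᶠ j → m j ≤ m i)
    → Σ ℕ λ n → IsBR k (suc s) m n
      × (k * m fzero + ΣFin s (λ i → m (fsuc i) ∸ 1) ≤ 2 ^ n)
      × (n ≤ ⌈log₂ (1 + ΣFin (suc s) (λ i → m i ∸ 1)) ⌉ + k ∸ 1)
theorem3p3 zero _ () _ _ _
theorem3p3 (suc k′) s _ ms ms≥1 _ =
  let (n , arrows-n , n-least) = least-witness (λ N → arrows? N (suc k′) (suc s) ms) U arrows-U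
  in n , (arrows-n , n-least) , lower-bound n k′ s ms ms≥1 arrows-n , n-least U arrows-U
  where
  n₀ = ⌈log₂ (1 + ΣFin (suc s) (λ i → ms i ∸ 1)) ⌉
  U = n₀ + suc k′ ∸ 1
  arrows-U : Arrows U (suc k′) (suc s) ms
  arrows-U = subst (λ N → Arrows N (suc k′) (suc s) ms) (cong (_∸ 1) (sym (+-suc n₀ k′)))
    (upper-bound n₀ k′ ms ms≥1 (n≤2^⌈log₂n⌉ _))
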